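{- Let $E(X)$ be an equation of the language $\mathcal L_1(M_2)$ whose only possible free variable is $X$ (of sort $\mathsf{list}$), such that $M_2\not\models E(X)$, and let $\lambda\in\mathfrak L\setminus\mathbb N^*$. Then there exists $N\in\mathbb N$ such that $M_2\not\models E(\lambda\uparrow n)$ for all $n\geq N$.
   Context: $\mathcal L_1$ has sorts $\mathsf i$, $\mathsf{list}$ and symbols $\mathit{nil}:\mathsf{list}$, $\mathit{cons}:\mathsf i\times\mathsf{list}\to\mathsf{list}$, infix $\frown:\mathsf{list}\times\mathsf{list}\to\mathsf{list}$. For a structure $M$, $\mathcal L(M)$ extends $\mathcal L$ by a constant for each element of $M$, interpreted by that element. Sequences: $\mathcal X^\alpha$ is the set of functions $\alpha\to\mathcal X$; $\mathbb N^*$ the finite sequences of naturals; $\varepsilon$ the empty sequence, $(n)$ a one-element sequence. For $a\in\mathcal X^\alpha$, $b\in\mathcal X^\beta$, $a\frown b\in\mathcal X^{\alpha+\beta}$ with $(a\frown b)_\gamma=a_\gamma$ for $\gamma<\alpha$ and $(a\frown b)_{\alpha+\delta}=b_\delta$. For $a\in\mathcal X^\alpha$ and $\beta\le\alpha$, the suffix $a\uparrow\beta$ is given by $(a\uparrow\beta)_\gamma=a_{\beta+\gamma}$ for $\gamma<\mu$, where $\beta+\mu=\alpha$. For $\alpha>0$ and $\mathfrak a\in(\mathcal X^\alpha)^\beta$, $\lfloor\mathfrak a\rfloor\in\mathcal X^{\alpha\cdot\beta}$ with $\lfloor\mathfrak a\rfloor_{\alpha\cdot\delta+\mu}=(\mathfrak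 a_\delta)_\mu$ for $\mu<\alpha$. $N_k=(i)_{k\le i<\omega}$, $\mathcal N=\{w\frown N_k: w\in\mathbb N^*,k\in\mathbb N\}$. The structure $M_2$ interprets $\mathsf i$ as $\mathbb N$, $\mathsf{list}$ as $\mathfrak L=\{\lfloor\mathfrak l\rfloor\frown w: w\in\mathbb N^*, \mathfrak l\in\mathcal N^\beta,\beta<\omega^2\}$, $\mathit{nil}$ as $\varepsilon$, $\mathit{cons}(n,l)$ as $(n)\frown l$, and $\frown$ as concatenation. -}

module Defs where

open import Data.Nat using (ℕ; zero; suc; _+_; _∸_; _<ᵇ_; _≡ᵇ_)
open import Data.Bool using (Bool; true; false; if_then_else_; _∧_; _∨_; T)
open import Data.List using (List; []; _∷_; length)
open import Data.Product using (Σ; _×_; _,_; ∃)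
open import Relation.Binary.PropositionalEquality using (_≡_)
open import Relation.Nullary using (¬_)

-- Ordinals below ω³ in Cantor normal form:  ⟨ a , b , c ⟩ = ω²·a + ω·b + c

record Ord : Set where
  constructor ⟨_,_,_⟩
  field
    o₂ o₁ o₀ : ℕ
open Ord public

fin : ℕ → Ord
fin n = ⟨ 0 , 0 , n ⟩

ω : Ord
ω = ⟨ 0 , 1 , 0 ⟩

_<ᵒᵇ_ : Ord → Ord → Bool
⟨ a , b , c ⟩ <ᵒᵇ ⟨ a' , b' , c' ⟩ =
  (a <ᵇ a') ∨ ((a ≡ᵇ a') ∧ ((b <ᵇ b') ∨ ((b ≡ᵇ b') ∧ (c <ᵇ c'))))

_<ₒ_ : Ord → Ord → Set
α <ₒ β = T (α <ᵒᵇ β)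

_+ₒ_ : Ord → Ord → Ord
⟨ a , b , c ⟩ +ₒ ⟨ zero , zero , c' ⟩ = ⟨ a , b , c + c' ⟩
⟨ a , b , c ⟩ +ₒ ⟨ zero , suc b' , c' ⟩ = ⟨ a , b + suc b' , c' ⟩
⟨ a , b , c ⟩ +ₒ ⟨ suc a' , b' , c' ⟩ = ⟨ a + suc a' , b' , c' ⟩

-- left subtraction: for β ≤ α, (α ∸ₒ β) is the unique μ with β +ₒ μ = α
_∸ₒ_ : Ord → Ord → Ord
⟨ a , b , c ⟩ ∸ₒ ⟨ a' , b' , c' ⟩ =
  if a' <ᵇ a then ⟨ a ∸ a' , b , c ⟩
  else (if b' <ᵇ b then ⟨ 0 , b ∸ b' , c ⟩ else ⟨ 0 , 0 , c ∸ c' ⟩)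

-- Transfinite sequences of naturals of length < ω³:
-- a length and a function on ordinals (only values below the length matter)

record Seq : Set where
  field
    len : Ord
    at  : Ord → ℕ
open Seq public

_≈ˢ_ : Seq → Seq → Set
s ≈ˢ t = (len s ≡ len t) × (∀ γ → γ <ₒ len s → at s γ ≡ at t γ)

_⁀_ : Seq → Seq → Seq
len (s ⁀ t) = len s +ₒ len t
at  (s ⁀ t) γ = if γ <ᵒᵇ len s then at s γ else at t (γ ∸ₒ len s)

_↑_ : Seq → Ord → Seq
len (s ↑ β) = len s ∸ₒ β
at  (s ↑ β) γ = at s (β +ₒ γ)

lookupD : List ℕ → ℕ → ℕ
lookupD []       _       = 0
lookupD (x ∷ xs) zero    = x
lookupD (x ∷ xs) (suc i) = lookupD xs i

fromList : List ℕ → Seq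
len (fromList w) = fin (length w)
at  (fromList w) ⟨ _ , _ , c ⟩ = lookupD w c

ε : Seq
ε = fromList []

⟦_⟧¹ : ℕ → Seq
⟦ n ⟧¹ = fromList (n ∷ [])

Nseq : ℕ → Seq
len (Nseq k) = ω
at  (Nseq k) ⟨ _ , _ , c ⟩ = k + c

InFinite : Seq → Set
InFinite s = Σ ℕ λ m → len s ≡ fin m

In𝒩 : Seq → Set
In𝒩 s = Σ (List ℕ) λ w → Σ ℕ λ k → s ≈ˢ (fromList w ⁀ Nseq k)

-- ⌊ 𝔩 ⌋ for 𝔩 ∈ (X^ω)^β with β = ω·p + q < ω²;
-- 𝔩 is given as a function of (i , j) standing for the index δ = ω·i + j,
-- and ⌊𝔩⌋_{ω·δ + μ} = (𝔩_δ)_μ.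
flat : ℕ → ℕ → (ℕ → ℕ → Seq) → Seq
len (flat p q 𝔩) = ⟨ p , q , 0 ⟩
at  (flat p q 𝔩) ⟨ a , b , c ⟩ = at (𝔩 a b) (fin c)

In𝔏 : Seq → Set
In𝔏 s =
  Σ ℕ λ p → Σ ℕ λ q → Σ (ℕ → ℕ → Seq) λ 𝔩 →
    (∀ i j → ⟨ 0 , i , j ⟩ <ₒ ⟨ 0 , p , q ⟩ → In𝒩 (𝔩 i j)) ×
    (Σ (List ℕ) λ w → s ≈ˢ (flat p q 𝔩 ⁀ fromList w))

data Sort : Set where
  ι lst : Sort

data Tm : Sort → Set where
  varX  : Tm lst
  cstι  : ℕ → Tm ι
  cstL  : (l : Seq) → In𝔏 l → Tm lst
  nil   : Tm lst
  cons  : Tm ι → Tm lst → Tm lst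
  _⌢_   : Tm lst → Tm lst → Tm lst

Dom : Sort → Set
Dom ι   = ℕ
Dom lst = Seq


EqD : (s : Sort) → Dom s → Dom s → Set
EqD ι   m n = m ≡ n
EqD lst l m = l ≈ˢ m

⟦_⟧ : ∀ {s} → Tm s → Seq → Dom s
⟦ varX ⟧     L = L
⟦ cstι n ⟧   L = n
⟦ cstL l _ ⟧ L = l
⟦ nil ⟧      L = ε
⟦ cons t u ⟧ L = ⟦ ⟦ t ⟧ L ⟧¹ ⁀ ⟦ u ⟧ L
⟦ t ⌢ u ⟧    L = ⟦ t ⟧ L ⁀ ⟦ u ⟧ L

record Equation : Set where
  constructor _≐_
  field
    {sort} : Sort
    lhs rhs : Tm sort

Holds : Equation → Seq → Set
Holds (t ≐ u) L = EqD _ (⟦ t ⟧ L) (⟦ u ⟧ L)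

Valid : Equation → Set
Valid E = ∀ L → In𝔏 L → Holds E L

{-# OPTIONS --safe #-}
-- Every list term of L₁(M₂) evaluates to c₀ ⁀ X ⁀ c₁ ⁀ X ⁀ ⋯ ⁀ X ⁀ cₖ for constants cᵢ
-- (equations between terms of sort i do not mention X at all).  If two such expressions
-- agree at some X whose first entry exceeds the finitely many entries of constants that an
-- occurrence of X could be compared with, the occurrences of X on the two sides must line
-- up, so the two sides agree for every X.  For an infinite λ ∈ 𝔏 with first block w ⁀ N_k,
-- the suffix λ ↑ n starts, for n ≥ |w|, at the entry k + (n − |w|) of N_k; so for large n
-- the equation E(λ ↑ n) would make E valid.
module Submission where

open import Data.Bool using (true; false; T)
open import Data.Bool.Properties using (T-∨; T-∧; T-≡)
open import Data.Empty using (⊥-elim)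
open import Data.List using (List; []; _∷_; length)
open import Data.List.NonEmpty using (List⁺; _∷_; _∷⁺_)
open import Data.Nat
  using (ℕ; zero; suc; _+_; _⊔_; _<ᵇ_; _<_; _≥_; s≤s; z<s; compare; less; equal; greater)
open import Data.Nat.Properties
open import Data.Product using (Σ; ∃; _×_; _,_; proj₁; proj₂)
open import Data.Sum using (_⊎_; inj₁; inj₂)
open import Data.Unit using (tt)
open import Function.Bundles using (Equivalence)
open import Relation.Binary.Bundles using (Setoid)
open import Relation.Binary.Consequences using (trans∧irr⇒asym)
open import Relation.Binary.Definitions
  using (Tri; tri<; tri≈; tri>; Trichotomous; Irreflexive; Transitive; Asymmetric)
open import Relation.Binary.PropositionalEquality
open import Relation.Binary.Structures using (IsEquivalence)
import Relation.Binary.Reasoning.Setoid as SetoidReasoning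
open import Level using (0ℓ)
open import Relation.Nullary using (¬_)

open import Defs

open Equivalence using (to; from)

infix 4 _≺_

data _≺_ : Ord → Ord → Set where
  lt₂ : ∀ {x y z a b c} → x < a → ⟨ x , y , z ⟩ ≺ ⟨ a , b , c ⟩
  lt₁ : ∀ {x y z b c} → y < b → ⟨ x , y , z ⟩ ≺ ⟨ x , b , c ⟩
  lt₀ : ∀ {x y z c} → z < c → ⟨ x , y , z ⟩ ≺ ⟨ x , y , c ⟩

≺⇒<ₒ : ∀ {γ α} → γ ≺ α → γ <ₒ α
≺⇒<ₒ (lt₂ p) = from T-∨ (inj₁ (<⇒<ᵇ p))
≺⇒<ₒ {⟨ x , _ , _ ⟩} (lt₁ p) =
  from T-∨ (inj₂ (from T-∧ (≡⇒≡ᵇ x x refl , from T-∨ (inj₁ (<⇒<ᵇ p)))))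
≺⇒<ₒ {⟨ x , y , _ ⟩} (lt₀ p) =
  from T-∨ (inj₂ (from T-∧ (≡⇒≡ᵇ x x refl , from T-∨ (inj₂ (from T-∧ (≡⇒≡ᵇ y y refl , <⇒<ᵇ p))))))

<ₒ⇒≺ : ∀ {γ α} → γ <ₒ α → γ ≺ α
<ₒ⇒≺ {⟨ x , y , z ⟩} {⟨ a , b , c ⟩} h with to T-∨ h
... | inj₁ x<a = lt₂ (<ᵇ⇒< x a x<a)
... | inj₂ h₁ with to T-∧ h₁
... | x≡a , h₂ with ≡ᵇ⇒≡ x a x≡a | to T-∨ h₂
... | refl | inj₁ y<b = lt₁ (<ᵇ⇒< y b y<b)
... | refl | inj₂ h₃ with to T-∧ h₃
... | y≡b , z<c with ≡ᵇ⇒≡ y b y≡b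
... | refl = lt₀ (<ᵇ⇒< z c z<c)

≺-irrefl : Irreflexive _≡_ _≺_
≺-irrefl refl (lt₂ p) = <-irrefl refl p
≺-irrefl refl (lt₁ p) = <-irrefl refl p
≺-irrefl refl (lt₀ p) = <-irrefl refl p

≺-trans : Transitive _≺_
≺-trans (lt₂ p) (lt₂ q) = lt₂ (<-trans p q)
≺-trans (lt₂ p) (lt₁ _) = lt₂ p
≺-trans (lt₂ p) (lt₀ _) = lt₂ p
≺-trans (lt₁ _) (lt₂ q) = lt₂ q
≺-trans (lt₁ p) (lt₁ q) = lt₁ (<-trans p q)
≺-trans (lt₁ p) (lt₀ _) = lt₁ p
≺-trans (lt₀ _) (lt₂ q) = lt₂ q
≺-trans (lt₀ _) (lt₁ q) = lt₁ q
≺-trans (lt₀ p) (lt₀ q) = lt₀ (<-trans p q)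

≺-asym : Asymmetric _≺_
≺-asym = trans∧irr⇒asym {_≈_ = _≡_} refl ≺-trans ≺-irrefl

private
  below : ∀ {α β} → α ≺ β → Tri (α ≺ β) (α ≡ β) (β ≺ α)
  below p = tri< p (λ e → ≺-irrefl e p) (≺-asym p)

  above : ∀ {α β} → β ≺ α → Tri (α ≺ β) (α ≡ β) (β ≺ α)
  above p = tri> (≺-asym p) (λ e → ≺-irrefl (sym e) p) p

≺-cmp : Trichotomous _≡_ _≺_
≺-cmp ⟨ x , y , z ⟩ ⟨ a , b , c ⟩ with <-cmp x a
... | tri< p _ _ = below (lt₂ p)
... | tri> _ _ p = above (lt₂ p)
... | tri≈ _ refl _ with <-cmp y b
...   | tri< p _ _ = below (lt₁ p)
...   | tri> _ _ p = above (lt₁ p)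
...   | tri≈ _ refl _ with <-cmp z c
...     | tri< p _ _ = below (lt₀ p)
...     | tri> _ _ p = above (lt₀ p)
...     | tri≈ _ refl _ = tri≈ (≺-irrefl refl) refl (≺-irrefl refl)

+ₒ-identityʳ : ∀ α → α +ₒ fin 0 ≡ α
+ₒ-identityʳ ⟨ a , b , c ⟩ = cong ⟨ a , b ,_⟩ (+-identityʳ c)

+ₒ-identityˡ : ∀ α → fin 0 +ₒ α ≡ α
+ₒ-identityˡ ⟨ zero  , zero  , c ⟩ = refl
+ₒ-identityˡ ⟨ zero  , suc b , c ⟩ = refl
+ₒ-identityˡ ⟨ suc a , b     , c ⟩ = refl

+ₒ-assoc : ∀ α β γ → (α +ₒ β) +ₒ γ ≡ α +ₒ (β +ₒ γ)
+ₒ-assoc ⟨ a , b , c ⟩ ⟨ zero , zero , c₁ ⟩ ⟨ zero , zero , c₂ ⟩ = cong ⟨ a , b ,_⟩ (+-assoc c c₁ c₂)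
+ₒ-assoc ⟨ a , b , c ⟩ ⟨ zero , zero , c₁ ⟩ ⟨ zero , suc b₂ , c₂ ⟩ = refl
+ₒ-assoc ⟨ a , b , c ⟩ ⟨ zero , zero , c₁ ⟩ ⟨ suc a₂ , b₂ , c₂ ⟩ = refl
+ₒ-assoc ⟨ a , b , c ⟩ ⟨ zero , suc b₁ , c₁ ⟩ ⟨ zero , zero , c₂ ⟩ = refl
+ₒ-assoc ⟨ a , b , c ⟩ ⟨ zero , suc b₁ , c₁ ⟩ ⟨ zero , suc b₂ , c₂ ⟩ =
  cong (λ v → ⟨ a , v , c₂ ⟩) (+-assoc b (suc b₁) (suc b₂))
+ₒ-assoc ⟨ a , b , c ⟩ ⟨ zero , suc b₁ , c₁ ⟩ ⟨ suc a₂ , b₂ , c₂ ⟩ = refl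
+ₒ-assoc ⟨ a , b , c ⟩ ⟨ suc a₁ , b₁ , c₁ ⟩ ⟨ zero , zero , c₂ ⟩ = refl
+ₒ-assoc ⟨ a , b , c ⟩ ⟨ suc a₁ , b₁ , c₁ ⟩ ⟨ zero , suc b₂ , c₂ ⟩ = refl
+ₒ-assoc ⟨ a , b , c ⟩ ⟨ suc a₁ , b₁ , c₁ ⟩ ⟨ suc a₂ , b₂ , c₂ ⟩ =
  cong (λ v → ⟨ v , b₂ , c₂ ⟩) (+-assoc a (suc a₁) (suc a₂))

private
  n<ᵇn≡false : ∀ n → (n <ᵇ n) ≡ false
  n<ᵇn≡false zero    = refl
  n<ᵇn≡false (suc n) = n<ᵇn≡false n

  n<ᵇn+1+k≡true : ∀ n k → (n <ᵇ n + suc k) ≡ true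
  n<ᵇn+1+k≡true n k = to T-≡ (<⇒<ᵇ (m<m+n n z<s))

+ₒ-∸ₒ-cancel : ∀ α δ → (α +ₒ δ) ∸ₒ α ≡ δ
+ₒ-∸ₒ-cancel ⟨ a , b , c ⟩ ⟨ zero , zero , c' ⟩
  rewrite n<ᵇn≡false a | n<ᵇn≡false b = cong ⟨ 0 , 0 ,_⟩ (m+n∸m≡n c c')
+ₒ-∸ₒ-cancel ⟨ a , b , c ⟩ ⟨ zero , suc b' , c' ⟩
  rewrite n<ᵇn≡false a | n<ᵇn+1+k≡true b b' = cong (λ v → ⟨ 0 , v , c' ⟩) (m+n∸m≡n b (suc b'))
+ₒ-∸ₒ-cancel ⟨ a , b , c ⟩ ⟨ suc a' , b' , c' ⟩
  rewrite n<ᵇn+1+k≡true a a' = cong (λ v → ⟨ v , b' , c' ⟩) (m+n∸m≡n a (suc a'))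

≺⊎≡+ₒ : ∀ γ α → γ ≺ α ⊎ ∃ λ δ → γ ≡ α +ₒ δ
≺⊎≡+ₒ ⟨ x , y , z ⟩ ⟨ a , b , c ⟩ with compare x a
... | less _ k = inj₁ (lt₂ (s≤s (m≤m+n x k)))
... | greater _ k = inj₂ (⟨ suc k , y , z ⟩ , cong ⟨_, y , z ⟩ (sym (+-suc a k)))
... | equal _ with compare y b
...   | less _ k = inj₁ (lt₁ (s≤s (m≤m+n y k)))
...   | greater _ k = inj₂ (⟨ 0 , suc k , z ⟩ , cong (λ v → ⟨ x , v , z ⟩) (sym (+-suc b k)))
...   | equal _ with compare z c
...     | less _ k = inj₁ (lt₀ (s≤s (m≤m+n z k)))
...     | equal _ = inj₂ (fin 0 , sym (+ₒ-identityʳ ⟨ x , y , z ⟩))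
...     | greater _ k = inj₂ (fin (suc k) , cong ⟨ x , y ,_⟩ (sym (+-suc c k)))

+ₒ-monoʳ-≺ : ∀ α {δ ε} → δ ≺ ε → α +ₒ δ ≺ α +ₒ ε
+ₒ-monoʳ-≺ ⟨ a , _ , _ ⟩ (lt₂ {zero} {zero} {_} {suc _} _) = lt₂ (m<m+n a z<s)
+ₒ-monoʳ-≺ ⟨ a , _ , _ ⟩ (lt₂ {zero} {suc _} {_} {suc _} _) = lt₂ (m<m+n a z<s)
+ₒ-monoʳ-≺ ⟨ a , _ , _ ⟩ (lt₂ {suc _} {_} {_} {suc _} p) = lt₂ (+-monoʳ-< a p)
+ₒ-monoʳ-≺ ⟨ _ , b , _ ⟩ (lt₁ {zero} {zero} {_} {suc _} _) = lt₁ (m<m+n b z<s)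
+ₒ-monoʳ-≺ ⟨ _ , b , _ ⟩ (lt₁ {zero} {suc _} {_} {suc _} p) = lt₁ (+-monoʳ-< b p)
+ₒ-monoʳ-≺ _ (lt₁ {suc _} p) = lt₁ p
+ₒ-monoʳ-≺ ⟨ _ , _ , c ⟩ (lt₀ {zero} {zero} p) = lt₀ (+-monoʳ-< c p)
+ₒ-monoʳ-≺ _ (lt₀ {zero} {suc _} p) = lt₀ p
+ₒ-monoʳ-≺ _ (lt₀ {suc _} p) = lt₀ p

≺⇒≺+ₒ : ∀ {γ α} β → γ ≺ α → γ ≺ α +ₒ β
≺⇒≺+ₒ ⟨ zero , zero , c' ⟩ (lt₂ p) = lt₂ p
≺⇒≺+ₒ ⟨ zero , zero , c' ⟩ (lt₁ p) = lt₁ p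
≺⇒≺+ₒ ⟨ zero , zero , c' ⟩ (lt₀ {c = c} p) = lt₀ (<-≤-trans p (m≤m+n c c'))
≺⇒≺+ₒ ⟨ zero , suc b' , c' ⟩ (lt₂ p) = lt₂ p
≺⇒≺+ₒ ⟨ zero , suc b' , c' ⟩ (lt₁ {b = b} p) = lt₁ (<-≤-trans p (m≤m+n b (suc b')))
≺⇒≺+ₒ ⟨ zero , suc b' , c' ⟩ (lt₀ {y = y} _) = lt₁ (m<m+n y z<s)
≺⇒≺+ₒ ⟨ suc a' , b' , c' ⟩ (lt₂ {a = a} p) = lt₂ (<-≤-trans p (m≤m+n a (suc a')))
≺⇒≺+ₒ ⟨ suc a' , b' , c' ⟩ (lt₁ {x = x} _) = lt₂ (m<m+n x z<s)
≺⇒≺+ₒ ⟨ suc a' , b' , c' ⟩ (lt₀ {x = x} _) = lt₂ (m<m+n x z<s)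

+ₒ-≮ : ∀ α δ → ¬ (α +ₒ δ ≺ α)
+ₒ-≮ α δ h = ≺-irrefl refl (≺⇒≺+ₒ δ h)

+ₒ-cancelˡ-≺ : ∀ α {δ ε} → α +ₒ δ ≺ α +ₒ ε → δ ≺ ε
+ₒ-cancelˡ-≺ α {δ} {ε} h with ≺-cmp δ ε
... | tri< p _ _ = p
... | tri≈ _ refl _ = ⊥-elim (≺-irrefl refl h)
... | tri> _ _ p = ⊥-elim (≺-asym h (+ₒ-monoʳ-≺ α p))

head : Seq → ℕ
head s = at s (fin 0)

NonEmpty : Seq → Set
NonEmpty s = fin 0 ≺ len s

at-≈ˢ : ∀ {s t} → s ≈ˢ t → ∀ {γ} → γ ≺ len s → at s γ ≡ at t γ
at-≈ˢ (_ , f) p = f _ (≺⇒<ₒ p)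

mk-≈ˢ : ∀ {s t} → len s ≡ len t → (∀ γ → γ ≺ len s → at s γ ≡ at t γ) → s ≈ˢ t
mk-≈ˢ e f = e , λ γ p → f γ (<ₒ⇒≺ p)

≈ˢ-isEquivalence : IsEquivalence _≈ˢ_
≈ˢ-isEquivalence = record
  { refl  = refl , λ _ _ → refl
  ; sym   = λ (e , f) → sym e , λ γ p → sym (f γ (subst (γ <ₒ_) (sym e) p))
  ; trans = λ (e , f) (e' , f') → trans e e' , λ γ p → trans (f γ p) (f' γ (subst (γ <ₒ_) e p))
  }

Seq-setoid : Setoid 0ℓ 0ℓ
Seq-setoid = record { isEquivalence = ≈ˢ-isEquivalence }

open Setoid Seq-setoid using () renaming (refl to ≈ˢ-refl; sym to ≈ˢ-sym; trans to ≈ˢ-trans)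

at-⁀ˡ : ∀ s t {γ} → γ ≺ len s → at (s ⁀ t) γ ≡ at s γ
at-⁀ˡ s t p rewrite to T-≡ (≺⇒<ₒ p) = refl

at-⁀ʳ : ∀ s t δ → at (s ⁀ t) (len s +ₒ δ) ≡ at t δ
at-⁀ʳ s t δ with (len s +ₒ δ) <ᵒᵇ len s in eq
... | true  = ⊥-elim (+ₒ-≮ (len s) δ (<ₒ⇒≺ (subst T (sym eq) tt)))
... | false = cong (at t) (+ₒ-∸ₒ-cancel (len s) δ)

⁀-cong : ∀ {s s' t t'} → s ≈ˢ s' → t ≈ˢ t' → (s ⁀ t) ≈ˢ (s' ⁀ t')
⁀-cong {s} {s'} {t} {t'} s≈s' t≈t' = mk-≈ˢ (cong₂ _+ₒ_ (proj₁ s≈s') (proj₁ t≈t')) pointwise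
  where
  open ≡-Reasoning
  pointwise : ∀ γ → γ ≺ len (s ⁀ t) → at (s ⁀ t) γ ≡ at (s' ⁀ t') γ
  pointwise γ p with ≺⊎≡+ₒ γ (len s)
  ... | inj₁ q = begin
    at (s ⁀ t) γ    ≡⟨ at-⁀ˡ s t q ⟩
    at s γ          ≡⟨ at-≈ˢ s≈s' q ⟩
    at s' γ         ≡⟨ at-⁀ˡ s' t' (subst (γ ≺_) (proj₁ s≈s') q) ⟨
    at (s' ⁀ t') γ  ∎
  ... | inj₂ (δ , refl) = begin
    at (s ⁀ t) (len s +ₒ δ)    ≡⟨ at-⁀ʳ s t δ ⟩
    at t δ                     ≡⟨ at-≈ˢ t≈t' (+ₒ-cancelˡ-≺ (len s) p) ⟩
    at t' δ                    ≡⟨ at-⁀ʳ s' t' δ ⟨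
    at (s' ⁀ t') (len s' +ₒ δ) ≡⟨ cong (λ α → at (s' ⁀ t') (α +ₒ δ)) (proj₁ s≈s') ⟨
    at (s' ⁀ t') (len s +ₒ δ)  ∎

⁀-congˡ : ∀ s {t t'} → t ≈ˢ t' → (s ⁀ t) ≈ˢ (s ⁀ t')
⁀-congˡ s = ⁀-cong (≈ˢ-refl {s})

⁀-assoc : ∀ s t u → ((s ⁀ t) ⁀ u) ≈ˢ (s ⁀ (t ⁀ u))
⁀-assoc s t u = mk-≈ˢ (+ₒ-assoc (len s) (len t) (len u)) pointwise
  where
  open ≡-Reasoning
  pointwise : ∀ γ → γ ≺ len ((s ⁀ t) ⁀ u) → at ((s ⁀ t) ⁀ u) γ ≡ at (s ⁀ (t ⁀ u)) γ
  pointwise γ _ with ≺⊎≡+ₒ γ (len s)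
  ... | inj₁ q = begin
    at ((s ⁀ t) ⁀ u) γ  ≡⟨ at-⁀ˡ (s ⁀ t) u (≺⇒≺+ₒ (len t) q) ⟩
    at (s ⁀ t) γ        ≡⟨ at-⁀ˡ s t q ⟩
    at s γ              ≡⟨ at-⁀ˡ s (t ⁀ u) q ⟨
    at (s ⁀ (t ⁀ u)) γ  ∎
  ... | inj₂ (δ , refl) with ≺⊎≡+ₒ δ (len t)
  ...   | inj₁ q = begin
    at ((s ⁀ t) ⁀ u) (len s +ₒ δ)  ≡⟨ at-⁀ˡ (s ⁀ t) u (+ₒ-monoʳ-≺ (len s) q) ⟩
    at (s ⁀ t) (len s +ₒ δ)        ≡⟨ at-⁀ʳ s t δ ⟩
    at t δ                         ≡⟨ at-⁀ˡ t u q ⟨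
    at (t ⁀ u) δ                   ≡⟨ at-⁀ʳ s (t ⁀ u) δ ⟨
    at (s ⁀ (t ⁀ u)) (len s +ₒ δ)  ∎
  ...   | inj₂ (μ , refl) = begin
    at ((s ⁀ t) ⁀ u) (len s +ₒ (len t +ₒ μ))  ≡⟨ cong (at ((s ⁀ t) ⁀ u)) (+ₒ-assoc (len s) (len t) μ) ⟨
    at ((s ⁀ t) ⁀ u) ((len s +ₒ len t) +ₒ μ)  ≡⟨ at-⁀ʳ (s ⁀ t) u μ ⟩
    at u μ                                    ≡⟨ at-⁀ʳ t u μ ⟨
    at (t ⁀ u) (len t +ₒ μ)                   ≡⟨ at-⁀ʳ s (t ⁀ u) (len t +ₒ μ) ⟨
    at (s ⁀ (t ⁀ u)) (len s +ₒ (len t +ₒ μ))  ∎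

⁀-identityʳ : ∀ s → (s ⁀ ε) ≈ˢ s
⁀-identityʳ s = mk-≈ˢ (+ₒ-identityʳ (len s)) λ γ p →
  at-⁀ˡ s ε (subst (γ ≺_) (+ₒ-identityʳ (len s)) p)

⁀-identityˡ : ∀ s → (ε ⁀ s) ≈ˢ s
⁀-identityˡ s = mk-≈ˢ (+ₒ-identityˡ (len s)) λ γ _ →
  trans (cong (at (ε ⁀ s)) (sym (+ₒ-identityˡ γ))) (at-⁀ʳ ε s γ)

⁀-cancel : ∀ s t s' t' → (s ⁀ t) ≈ˢ (s' ⁀ t') → len s ≡ len s' → (s ≈ˢ s') × (t ≈ˢ t')
⁀-cancel s t s' t' h e = mk-≈ˢ e on-s , mk-≈ˢ len-t≡len-t' on-t
  where
  open ≡-Reasoning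
  len-t≡len-t' : len t ≡ len t'
  len-t≡len-t' = begin
    len t                         ≡⟨ +ₒ-∸ₒ-cancel (len s) (len t) ⟨
    (len s +ₒ len t) ∸ₒ len s     ≡⟨ cong (_∸ₒ len s) (proj₁ h) ⟩
    (len s' +ₒ len t') ∸ₒ len s   ≡⟨ cong (λ α → (α +ₒ len t') ∸ₒ len s) e ⟨
    (len s +ₒ len t') ∸ₒ len s    ≡⟨ +ₒ-∸ₒ-cancel (len s) (len t') ⟩
    len t'                        ∎

  on-s : ∀ γ → γ ≺ len s → at s γ ≡ at s' γ
  on-s γ q = begin
    at s γ           ≡⟨ at-⁀ˡ s t q ⟨
    at (s ⁀ t) γ     ≡⟨ at-≈ˢ h (≺⇒≺+ₒ (len t) q) ⟩
    at (s' ⁀ t') γ   ≡⟨ at-⁀ˡ s' t' (subst (γ ≺_) e q) ⟩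
    at s' γ          ∎

  on-t : ∀ δ → δ ≺ len t → at t δ ≡ at t' δ
  on-t δ q = begin
    at t δ                      ≡⟨ at-⁀ʳ s t δ ⟨
    at (s ⁀ t) (len s +ₒ δ)     ≡⟨ at-≈ˢ h (+ₒ-monoʳ-≺ (len s) q) ⟩
    at (s' ⁀ t') (len s +ₒ δ)   ≡⟨ cong (λ α → at (s' ⁀ t') (α +ₒ δ)) e ⟩
    at (s' ⁀ t') (len s' +ₒ δ)  ≡⟨ at-⁀ʳ s' t' δ ⟩
    at t' δ                     ∎

at-len-prefix : ∀ s s' t → s ≈ˢ (s' ⁀ t) → NonEmpty t → at s (len s') ≡ head t
at-len-prefix s s' t h t≠ε = begin
  at s (len s')                 ≡⟨ at-≈ˢ h (subst (len s' ≺_) (sym (proj₁ h)) s'≺s't) ⟩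
  at (s' ⁀ t) (len s')          ≡⟨ cong (at (s' ⁀ t)) (+ₒ-identityʳ (len s')) ⟨
  at (s' ⁀ t) (len s' +ₒ fin 0) ≡⟨ at-⁀ʳ s' t (fin 0) ⟩
  head t                        ∎
  where
  open ≡-Reasoning
  s'≺s't : len s' ≺ len s' +ₒ len t
  s'≺s't = subst (_≺ len s' +ₒ len t) (+ₒ-identityʳ (len s')) (+ₒ-monoʳ-≺ (len s') t≠ε)

fill : Seq → List Seq → Seq → Seq
fill c []       L = c
fill c (d ∷ ds) L = c ⁀ (L ⁀ fill d ds L)

fill⁺ : List⁺ Seq → Seq → Seq
fill⁺ (c ∷ cs) = fill c cs

glue : Seq → List Seq → List⁺ Seq → List⁺ Seq
glue c []       (d ∷ ds) = (c ⁀ d) ∷ ds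
glue c (e ∷ es) Q        = c ∷⁺ glue e es Q

fill-glue : ∀ c cs Q L → fill⁺ (glue c cs Q) L ≈ˢ (fill c cs L ⁀ fill⁺ Q L)
fill-glue c []       (d ∷ [])      L = ≈ˢ-refl
fill-glue c []       (d ∷ e ∷ es)  L = ⁀-assoc c d (L ⁀ fill e es L)
fill-glue c (e ∷ es) Q             L = begin
  c ⁀ (L ⁀ fill⁺ (glue e es Q) L)             ≈⟨ ⁀-congˡ c (⁀-congˡ L (fill-glue e es Q L)) ⟩
  c ⁀ (L ⁀ (fill e es L ⁀ fill⁺ Q L))         ≈⟨ ⁀-congˡ c (⁀-assoc L (fill e es L) (fill⁺ Q L)) ⟨
  c ⁀ ((L ⁀ fill e es L) ⁀ fill⁺ Q L)         ≈⟨ ⁀-assoc c (L ⁀ fill e es L) (fill⁺ Q L) ⟨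
  (c ⁀ (L ⁀ fill e es L)) ⁀ fill⁺ Q L         ∎
  where open SetoidReasoning Seq-setoid

segments : Tm lst → List⁺ Seq
segments varX              = ε ∷ ε ∷ []
segments (cstL l _)        = l ∷ []
segments nil               = ε ∷ []
segments (cons (cstι n) u) = glue ⟦ n ⟧¹ [] (segments u)
segments (t ⌢ u)           = glue (List⁺.head (segments t)) (List⁺.tail (segments t)) (segments u)

⟦⟧≈fill-segments : ∀ t L → ⟦ t ⟧ L ≈ˢ fill⁺ (segments t) L
⟦⟧≈fill-segments varX       L = ≈ˢ-sym (≈ˢ-trans (⁀-identityˡ (L ⁀ ε)) (⁀-identityʳ L))
⟦⟧≈fill-segments (cstL l _) L = ≈ˢ-refl
⟦⟧≈fill-segments nil        L = ≈ˢ-refl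
⟦⟧≈fill-segments (cons (cstι n) u) L =
  ≈ˢ-trans (⁀-congˡ ⟦ n ⟧¹ (⟦⟧≈fill-segments u L)) (≈ˢ-sym (fill-glue ⟦ n ⟧¹ [] (segments u) L))
⟦⟧≈fill-segments (t ⌢ u) L =
  ≈ˢ-trans (⁀-cong (⟦⟧≈fill-segments t L) (⟦⟧≈fill-segments u L))
           (≈ˢ-sym (fill-glue (List⁺.head (segments t)) (List⁺.tail (segments t)) (segments u) L))

misaligned : ∀ s c X R → NonEmpty X → s ≈ˢ (c ⁀ (X ⁀ R)) → at s (len c) ≡ head X
misaligned s c X R X≠ε h = trans (at-len-prefix s c (X ⁀ R) h (≺⇒≺+ₒ (len R) X≠ε)) (at-⁀ˡ X R X≠ε)

fill-rigid : ∀ c cs c' cs' → Σ ℕ λ B → ∀ X → NonEmpty X → B < head X →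
  fill c cs X ≈ˢ fill c' cs' X → ∀ L → fill c cs L ≈ˢ fill c' cs' L
fill-rigid c [] c' [] = 0 , λ _ _ _ h _ → h
fill-rigid c [] c' (d' ∷ ds') = at c (len c') , λ X X≠ε B<X h _ →
  ⊥-elim (<-irrefl (misaligned c c' X (fill d' ds' X) X≠ε h) B<X)
fill-rigid c (d ∷ ds) c' [] = at c' (len c) , λ X X≠ε B<X h _ →
  ⊥-elim (<-irrefl (misaligned c' c X (fill d ds X) X≠ε (≈ˢ-sym h)) B<X)
fill-rigid c (d ∷ ds) c' (d' ∷ ds') with fill-rigid d ds d' ds'
... | B , rest-rigid = (at c' (len c) ⊔ at c (len c')) ⊔ B , λ X X≠ε bound →
  let bound₁₂ : at c' (len c) ⊔ at c (len c') < head X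
      bound₁₂ = m⊔n<o⇒m<o (at c' (len c) ⊔ at c (len c')) B bound
  in
  rigid X X≠ε (m⊔n<o⇒m<o (at c' (len c)) (at c (len c')) bound₁₂)
              (m⊔n<o⇒n<o (at c' (len c)) (at c (len c')) bound₁₂)
              (m⊔n<o⇒n<o (at c' (len c) ⊔ at c (len c')) B bound)
  where
  rigid : ∀ X → NonEmpty X → at c' (len c) < head X → at c (len c') < head X → B < head X →
    fill c (d ∷ ds) X ≈ˢ fill c' (d' ∷ ds') X → ∀ L → fill c (d ∷ ds) L ≈ˢ fill c' (d' ∷ ds') L
  rigid X X≠ε c'<X c<X B<X h L with ≺-cmp (len c) (len c')
  ... | tri< c≺c' _ _ = ⊥-elim (<-irrefl c'-meets-X c'<X)
    where
    c'-meets-X : at c' (len c) ≡ head X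
    c'-meets-X = trans (sym (at-⁀ˡ c' (X ⁀ fill d' ds' X) c≺c'))
                       (misaligned (fill c' (d' ∷ ds') X) c X (fill d ds X) X≠ε (≈ˢ-sym h))
  ... | tri> _ _ c'≺c = ⊥-elim (<-irrefl c-meets-X c<X)
    where
    c-meets-X : at c (len c') ≡ head X
    c-meets-X = trans (sym (at-⁀ˡ c (X ⁀ fill d ds X) c'≺c))
                      (misaligned (fill c (d ∷ ds) X) c' X (fill d' ds' X) X≠ε h)
  ... | tri≈ _ e _ with ⁀-cancel c (X ⁀ fill d ds X) c' (X ⁀ fill d' ds' X) h e
  ...   | c≈c' , XR≈XR' = ⁀-cong c≈c' (⁀-congˡ L (rest-rigid X X≠ε B<X R≈R' L))
    where
    R≈R' : fill d ds X ≈ˢ fill d' ds' X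
    R≈R' = proj₂ (⁀-cancel X (fill d ds X) X (fill d' ds' X) XR≈XR' refl)

equation-rigid : (t u : Tm lst) → Σ ℕ λ B → ∀ X → NonEmpty X → B < head X →
  Holds (t ≐ u) X → ∀ L → Holds (t ≐ u) L
equation-rigid t u with fill-rigid (List⁺.head (segments t)) (List⁺.tail (segments t))
                                   (List⁺.head (segments u)) (List⁺.tail (segments u))
... | B , rigid = B , λ X X≠ε B<X t≈u L → begin
  ⟦ t ⟧ L                    ≈⟨ ⟦⟧≈fill-segments t L ⟩
  fill⁺ (segments t) L       ≈⟨ rigid X X≠ε B<X (fill-segments-agree X t≈u) L ⟩
  fill⁺ (segments u) L       ≈⟨ ⟦⟧≈fill-segments u L ⟨
  ⟦ u ⟧ L                    ∎
  where
  open SetoidReasoning Seq-setoid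
  fill-segments-agree : ∀ X → ⟦ t ⟧ X ≈ˢ ⟦ u ⟧ X → fill⁺ (segments t) X ≈ˢ fill⁺ (segments u) X
  fill-segments-agree X t≈u = begin
    fill⁺ (segments t) X     ≈⟨ ⟦⟧≈fill-segments t X ⟨
    ⟦ t ⟧ X                  ≈⟨ t≈u ⟩
    ⟦ u ⟧ X                  ≈⟨ ⟦⟧≈fill-segments u X ⟩
    fill⁺ (segments u) X     ∎

data Infinite : Ord → Set where
  ω²≤ : ∀ {a b c} → Infinite ⟨ suc a , b , c ⟩
  ω≤  : ∀ {b c} → Infinite ⟨ 0 , suc b , c ⟩

fin≺infinite : ∀ {α} n → Infinite α → fin n ≺ α
fin≺infinite n ω²≤ = lt₂ z<s
fin≺infinite n ω≤  = lt₁ z<s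

infinite-+ₒ-fin : ∀ {α} m → Infinite α → Infinite (α +ₒ fin m)
infinite-+ₒ-fin m ω²≤ = ω²≤
infinite-+ₒ-fin m ω≤  = ω≤

infinite-∸ₒ-fin : ∀ {α} n → Infinite α → Infinite (α ∸ₒ fin n)
infinite-∸ₒ-fin n ω²≤ = ω²≤
infinite-∸ₒ-fin n ω≤  = ω≤

suffix-heads-grow : ∀ {p q} 𝔩 w λ' → Infinite ⟨ p , q , 0 ⟩ → In𝒩 (𝔩 0 0) →
  λ' ≈ˢ (flat p q 𝔩 ⁀ fromList w) →
  ∀ B → Σ ℕ λ N → ∀ n → n ≥ N → NonEmpty (λ' ↑ fin n) × B < head (λ' ↑ fin n)
suffix-heads-grow {p} {q} 𝔩 w λ' pq-infinite (w₀ , k , 𝔩₀≈) λ'≈ B = length w₀ + suc B , grows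
  where
  open ≡-Reasoning

  λ'-infinite : Infinite (len λ')
  λ'-infinite = subst Infinite (sym (proj₁ λ'≈)) (infinite-+ₒ-fin (length w) pq-infinite)

  head-suffix : ∀ m → head (λ' ↑ fin (length w₀ + m)) ≡ k + m
  head-suffix m = begin
    at λ' (fin n +ₒ fin 0)
      ≡⟨ cong (at λ') (+ₒ-identityʳ (fin n)) ⟩
    at λ' (fin n)
      ≡⟨ at-≈ˢ λ'≈ (fin≺infinite n λ'-infinite) ⟩
    at (flat p q 𝔩 ⁀ fromList w) (fin n)
      ≡⟨ at-⁀ˡ (flat p q 𝔩) (fromList w) (fin≺infinite n pq-infinite) ⟩
    at (𝔩 0 0) (fin n)
      ≡⟨ at-≈ˢ 𝔩₀≈ (subst (fin n ≺_) (sym (proj₁ 𝔩₀≈)) (lt₁ z<s)) ⟩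
    at (fromList w₀ ⁀ Nseq k) (fin n)
      ≡⟨ at-⁀ʳ (fromList w₀) (Nseq k) (fin m) ⟩
    k + m
      ∎
    where
    n : ℕ
    n = length w₀ + m

  grows : ∀ n → n ≥ length w₀ + suc B → NonEmpty (λ' ↑ fin n) × B < head (λ' ↑ fin n)
  grows n N≤n with m≤n⇒∃[o]m+o≡n N≤n
  ... | o , refl =
    fin≺infinite 0 (infinite-∸ₒ-fin n λ'-infinite) ,
    subst (λ n → B < head (λ' ↑ fin n)) (sym (+-assoc (length w₀) (suc B) o))
          (subst (B <_) (sym (head-suffix (suc B + o))) (≤-trans (m≤m+n (suc B) o) (m≤n+m _ k)))

𝔏-suffix-heads-grow : ∀ λ' → In𝔏 λ' → ¬ InFinite λ' →
  ∀ B → Σ ℕ λ N → ∀ n → n ≥ N → NonEmpty (λ' ↑ fin n) × B < head (λ' ↑ fin n)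
𝔏-suffix-heads-grow λ' (zero , zero , _ , _ , w , λ'≈) λ'∉ℕ* =
  ⊥-elim (λ'∉ℕ* (length w , proj₁ λ'≈))
𝔏-suffix-heads-grow λ' (suc p , q , 𝔩 , 𝔩∈𝒩 , w , λ'≈) _ =
  suffix-heads-grow 𝔩 w λ' ω²≤ (𝔩∈𝒩 0 0 tt) λ'≈
𝔏-suffix-heads-grow λ' (zero , suc q , 𝔩 , 𝔩∈𝒩 , w , λ'≈) _ =
  suffix-heads-grow 𝔩 w λ' ω≤ (𝔩∈𝒩 0 0 tt) λ'≈

lemma4p13 : (E : Equation) → ¬ Valid E →
    (λ' : Seq) → In𝔏 λ' → ¬ InFinite λ' →
    Σ ℕ λ N → ∀ n → n ≥ N → ¬ Holds E (λ' ↑ fin n)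
lemma4p13 (_≐_ {ι} (cstι a) (cstι b)) invalid _ _ _ = 0 , λ _ _ a≡b → invalid (λ _ _ → a≡b)
lemma4p13 (_≐_ {lst} t u) invalid λ' λ'∈𝔏 λ'∉ℕ* with equation-rigid t u
... | B , rigid with 𝔏-suffix-heads-grow λ' λ'∈𝔏 λ'∉ℕ* B
... | N , grows = N , λ n N≤n holds →
  let (nonempty , B<head) = grows n N≤n in
  invalid (λ L _ → rigid (λ' ↑ fin n) nonempty B<head holds L)
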